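{- Let $T$ be a tree and let $T_1,T_2$ be subtrees of $T$ such that $T_1\cap T_2$ is nonempty and $\mathrm{diam}(T_1\cap T_2)=\mathrm{diam}(T_1)$. Then $\mathrm{diam}(T_1\cup T_2)=\mathrm{diam}(T_2)$.
   Context: Subtrees are connected subgraphs of $T$; $T_1\cap T_2$ and $T_1\cup T_2$ denote the subgraphs induced by the intersection and union of their node sets; $\mathrm{diam}$ is the diameter. -}

module Defs where

open import Level using (0ℓ)
open import Data.Nat using (ℕ; zero; suc; _≤_)
open import Data.Fin using (Fin)
open import Data.List using (List; []; _∷_; length; _∷ʳ_)
open import Data.List.Relation.Unary.Unique.Propositional using (Unique)
open import Data.List.Relation.Unary.Linked using (Linked)
open import Data.Product using (Σ; ∃; ∃-syntax; _×_)
open import Data.Sum using (_⊎_)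
open import Data.Unit using (⊤)
open import Relation.Nullary using (¬_)
open import Relation.Binary.PropositionalEquality using (_≡_)

record Graph (n : ℕ) : Set₁ where
  field
    Adj     : Fin n → Fin n → Set
    sym     : ∀ {u v} → Adj u v → Adj v u
    irrefl  : ∀ {u} → ¬ Adj u u
open Graph public

-- Vertex subsets as predicates; subgraphs are the induced subgraphs on them.
VSet : ℕ → Set₁
VSet n = Fin n → Set

_∩_ : ∀ {n} → VSet n → VSet n → VSet n
(S ∩ R) x = S x × R x

_∪_ : ∀ {n} → VSet n → VSet n → VSet n
(S ∪ R) x = S x ⊎ R x

Nonempty : ∀ {n} → VSet n → Set
Nonempty S = ∃[ x ] S x

data Walk {n} (G : Graph n) (S : VSet n) : Fin n → Fin n → ℕ → Set where
  here : ∀ {u} → S u → Walk G S u u zero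
  step : ∀ {u w v k} → S u → Adj G u w → Walk G S w v k → Walk G S u v (suc k)

Connected : ∀ {n} → Graph n → VSet n → Set
Connected G S = ∀ u v → S u → S v → ∃[ k ] Walk G S u v k

Cycle : ∀ {n} → Graph n → Set
Cycle {n} G = Σ (Fin n) λ x → Σ (List (Fin n)) λ ys → Σ (Fin n) λ y →
  1 ≤ length ys × Unique (x ∷ (ys ∷ʳ y)) × Linked (Adj G) (x ∷ (ys ∷ʳ y)) × Adj G y x

IsTree : ∀ {n} → Graph n → Set
IsTree {n} G = Nonempty {n} (λ _ → ⊤) × Connected G (λ _ → ⊤) × ¬ Cycle G

IsSubtree : ∀ {n} → Graph n → VSet n → Set
IsSubtree G S = Connected G S

Dist : ∀ {n} → Graph n → VSet n → Fin n → Fin n → ℕ → Set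
Dist G S u v d = Walk G S u v d × (∀ k → Walk G S u v k → d ≤ k)

IsDiam : ∀ {n} → Graph n → VSet n → ℕ → Set
IsDiam G S d =
  (∃[ u ] ∃[ v ] (S u × S v × Dist G S u v d)) ×
  (∀ u v k → S u → S v → Dist G S u v k → k ≤ d)

-- In a tree T any two vertices are joined by a unique path; its length δ a b is
-- the tree distance.  It is also the distance inside every connected vertex set
-- S containing a and b, because a shortest walk inside S erases to a path
-- inside S, which must be the tree path.  So each diameter in the statement is
-- the maximum of δ over pairs of vertices of the corresponding set.
--
-- Let u, v ∈ T₁ ∩ T₂ realise diam(T₁ ∩ T₂) = diam(T₁) = δ u v.  The key metric
-- fact ('far-from-both'): if x is within δ u v of both u and v, then any y has
-- δ x y ≤ δ y u or δ x y ≤ δ y v.  It is read off at the branch point m of the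
-- paths x → u and x → v: x is no farther from m than u and v are, and the path
-- from m to y leaves m away from one of the branches m → u, m → v.  Hence
-- δ x y ≤ diam(T₂) for x ∈ T₁, y ∈ T₂; pairs inside T₁ are bounded by
-- δ u v ≤ diam(T₂); and T₂ ⊆ T₁ ∪ T₂ gives the reverse inequality.
module Submission where

open import Defs
open import Data.Nat using (ℕ; suc; _+_; _≤_; z≤n; s≤s)
open import Data.Nat.Properties
  using (≤-trans; ≤-antisym; n≤1+n; m≤n⇒m≤1+n; +-suc; +-comm; +-identityʳ; +-monoˡ-≤; +-cancelʳ-≤; module ≤-Reasoning)
open import Data.Fin using (Fin; _≟_)
open import Data.List using (List; []; _∷_; length; _∷ʳ_; _++_)
open import Data.List.Properties using (length-++)
open import Data.List.Membership.Propositional using (_∈_; _∉_)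
open import Data.List.Relation.Unary.Any using (here; there)
open import Data.List.Relation.Unary.All using (All; []; _∷_; universal-U)
open import Data.List.Relation.Unary.All.Properties using (¬Any⇒All¬)
open import Data.List.Relation.Unary.Unique.Propositional using (Unique)
open import Data.List.Relation.Unary.AllPairs using ([]; _∷_)
open import Data.List.Relation.Unary.Linked using (Linked; [-]; _∷_)
open import Data.List.Relation.Binary.Prefix.Heterogeneous using (Prefix; []; _∷_)
open import Data.Product using (Σ; ∃-syntax; _×_; _,_; proj₁; proj₂)
open import Data.Sum using (_⊎_; inj₁; inj₂)
open import Data.Unit using (⊤; tt)
open import Data.Empty using (⊥; ⊥-elim)
open import Relation.Nullary using (¬_; yes; no)
open import Relation.Unary using (U)
open import Relation.Binary.PropositionalEquality
  using (_≡_; refl; trans; cong; subst; subst₂; module ≡-Reasoning) renaming (sym to ≡-sym)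

-- Walks of G represented as a start vertex followed by the list of the
-- remaining vertices; a path is such a walk with distinct vertices.
module Paths {n : ℕ} (G : Graph n) where

  open import Data.List.Membership.DecPropositional (_≟_ {n}) using (_∈?_)

  V : Set
  V = Fin n

  data Chain : V → List V → Set where
    [] : ∀ {a} → Chain a []
    _∷_ : ∀ {a x xs} → Adj G a x → Chain x xs → Chain a (x ∷ xs)

  data Distinct : List V → Set where
    [] : Distinct []
    _∷_ : ∀ {x xs} → x ∉ xs → Distinct xs → Distinct (x ∷ xs)

  end : V → List V → V
  end a [] = a
  end a (x ∷ xs) = end x xs

  end-∈ : ∀ a xs → end a xs ∈ a ∷ xs
  end-∈ a [] = here refl
  end-∈ a (x ∷ xs) = there (end-∈ x xs)

  chain⇒linked : ∀ {a xs} → Chain a xs → Linked (Adj G) (a ∷ xs)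
  chain⇒linked [] = [-]
  chain⇒linked (ax ∷ c) = ax ∷ chain⇒linked c

  distinct⇒unique : ∀ {xs} → Distinct xs → Unique xs
  distinct⇒unique [] = []
  distinct⇒unique (_∷_ {xs = xs} x∉ d) = ¬Any⇒All¬ xs x∉ ∷ distinct⇒unique d

  _⊑_ : List V → List V → Set
  _⊑_ = Prefix _≡_

  ⊑-∈ : ∀ {ys xs z} → ys ⊑ xs → z ∈ ys → z ∈ xs
  ⊑-∈ (refl ∷ p) (here e) = here e
  ⊑-∈ (refl ∷ p) (there z∈) = there (⊑-∈ p z∈)

  ⊑-distinct : ∀ {ys xs} → ys ⊑ xs → Distinct xs → Distinct ys
  ⊑-distinct [] _ = []
  ⊑-distinct (refl ∷ p) (x∉ ∷ d) = (λ x∈ → x∉ (⊑-∈ p x∈)) ∷ ⊑-distinct p d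

  ⊑-chain : ∀ {a ys xs} → ys ⊑ xs → Chain a xs → Chain a ys
  ⊑-chain [] _ = []
  ⊑-chain (refl ∷ p) (ax ∷ c) = ax ∷ ⊑-chain p c

  cut : ∀ {z} a xs → z ∈ a ∷ xs → ∃[ ys ] ys ⊑ xs × end a ys ≡ z
  cut a xs (here refl) = [] , [] , refl
  cut a (x ∷ xs) (there z∈) with cut x xs z∈
  ... | ys , ys⊑xs , e = x ∷ ys , refl ∷ ys⊑xs , e

  butLast : V → List V → List V
  butLast a [] = []
  butLast a (x ∷ xs) = a ∷ butLast x xs

  butLast-end : ∀ a xs → a ∷ xs ≡ butLast a xs ∷ʳ end a xs
  butLast-end a [] = refl
  butLast-end a (x ∷ xs) = cong (a ∷_) (butLast-end x xs)

  close-cycle : ∀ {c b y zs} → Chain c (b ∷ y ∷ zs) → Distinct (c ∷ b ∷ y ∷ zs) →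
                Adj G (end y zs) c → Cycle G
  close-cycle {c} {b} {y} {zs} ch d closing =
    c , butLast b (y ∷ zs) , end y zs , s≤s z≤n ,
    subst (λ l → Unique (c ∷ l)) (butLast-end b (y ∷ zs)) (distinct⇒unique d) ,
    subst (λ l → Linked (Adj G) (c ∷ l)) (butLast-end b (y ∷ zs)) (chain⇒linked ch) ,
    closing

  record PathIn (P : V → Set) (a b : V) (k : ℕ) : Set where
    constructor pathIn
    field
      verts : List V
      chain : Chain a verts
      distinct : Distinct (a ∷ verts)
      inside : All P verts
      ends : end a verts ≡ b
      short : length verts ≤ k
  open PathIn public

  suffix-from : ∀ {P x b k a} (p : PathIn P x b k) → a ∈ x ∷ verts p → PathIn P a b k
  suffix-from p (here refl) = p
  suffix-from (pathIn (y ∷ ys) (_ ∷ c) (_ ∷ d) (_ ∷ ps) e l) (there a∈) =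
    suffix-from (pathIn ys c d ps e (≤-trans (n≤1+n _) l)) a∈

  erase : ∀ {P a} xs → Chain a xs → All P xs → PathIn P a (end a xs) (length xs)
  erase [] [] [] = pathIn [] [] ((λ ()) ∷ []) [] refl z≤n
  erase {a = a} (x ∷ xs) (ax ∷ c) (px ∷ ps) with erase xs c ps
  ... | p with a ∈? (x ∷ verts p)
  ...   | yes a∈ = let q = suffix-from p a∈ in
                   pathIn (verts q) (chain q) (distinct q) (inside q) (ends q) (m≤n⇒m≤1+n (short q))
  ...   | no a∉ = pathIn (x ∷ verts p) (ax ∷ chain p) (a∉ ∷ distinct p) (px ∷ inside p) (ends p) (s≤s (short p))

  walk-vertices : ∀ {S u v k} → Walk G S u v k →
    ∃[ xs ] Chain u xs × S u × All S xs × end u xs ≡ v × length xs ≡ k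
  walk-vertices (here su) = [] , [] , su , [] , refl , refl
  walk-vertices (step su a w) with walk-vertices w
  ... | xs , c , sw , ps , e , l = _ ∷ xs , a ∷ c , su , sw ∷ ps , e , cong suc l

  walk⇒path : ∀ {S u v k} → Walk G S u v k → S u × PathIn S u v k
  walk⇒path w with walk-vertices w
  ... | xs , c , su , ps , e , l = su , subst₂ (PathIn _ _) e l (erase xs c ps)

  path⇒walk : ∀ {S a b k} → S a → (p : PathIn S a b k) → Walk G S a b (length (verts p))
  path⇒walk {S} sa (pathIn xs c _ ps refl _) = chain-walk sa c ps
    where
      chain-walk : ∀ {u xs} → S u → Chain u xs → All S xs → Walk G S u (end u xs) (length xs)
      chain-walk su [] [] = here su
      chain-walk su (a ∷ c) (sx ∷ ps) = step su a (chain-walk sx c ps)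

  lift-walk : ∀ {S S′ a b k} → (∀ {z} → S z → S′ z) → Walk G S a b k → Walk G S′ a b k
  lift-walk S⊆S′ (here sa) = here (S⊆S′ sa)
  lift-walk S⊆S′ (step sa ab w) = step (S⊆S′ sa) ab (lift-walk S⊆S′ w)

  chain-++ : ∀ {a} xs ys → Chain a xs → Chain (end a xs) ys → Chain a (xs ++ ys)
  chain-++ [] ys [] c = c
  chain-++ (x ∷ xs) ys (ax ∷ c) c' = ax ∷ chain-++ xs ys c c'

  end-++ : ∀ a xs ys → end a (xs ++ ys) ≡ end (end a xs) ys
  end-++ a [] ys = refl
  end-++ a (x ∷ xs) ys = end-++ x xs ys

  -- revGlue m α β walks from end m α back along α to m and then along β.
  revGlue : V → List V → List V → List V
  revGlue m [] β = β
  revGlue m (x ∷ α) β = revGlue x α (m ∷ β)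

  revGlue-chain : ∀ m α β → Chain m α → Chain m β → Chain (end m α) (revGlue m α β)
  revGlue-chain m [] β [] cβ = cβ
  revGlue-chain m (x ∷ α) β (mx ∷ cα) cβ = revGlue-chain x α (m ∷ β) cα (sym G mx ∷ cβ)

  revGlue-end : ∀ m α β → end (end m α) (revGlue m α β) ≡ end m β
  revGlue-end m [] β = refl
  revGlue-end m (x ∷ α) β = revGlue-end x α (m ∷ β)

  revGlue-length : ∀ m α β → length (revGlue m α β) ≡ length α + length β
  revGlue-length m [] β = refl
  revGlue-length m (x ∷ α) β = trans (revGlue-length x α (m ∷ β)) (+-suc (length α) (length β))

  revGlue-distinct : ∀ m α β → Distinct (m ∷ α) → Distinct (m ∷ β) →
                     (∀ z → z ∈ α → z ∈ β → ⊥) → Distinct (end m α ∷ revGlue m α β)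
  revGlue-distinct m [] β _ dβ _ = dβ
  revGlue-distinct m (x ∷ α) β (m∉ ∷ x∉ ∷ dα) dβ disjoint =
    revGlue-distinct x α (m ∷ β) (x∉ ∷ dα) (x∉m∷β ∷ dβ) disjoint′
    where
      x∉m∷β : x ∉ m ∷ β
      x∉m∷β (here refl) = m∉ (here refl)
      x∉m∷β (there x∈β) = disjoint x (here refl) x∈β
      disjoint′ : ∀ z → z ∈ α → z ∈ m ∷ β → ⊥
      disjoint′ z z∈α (here refl) = m∉ (there z∈α)
      disjoint′ z z∈α (there z∈β) = disjoint z (there z∈α) z∈β

  Diverge : List V → List V → Set
  Diverge [] _ = ⊤
  Diverge (_ ∷ _) [] = ⊤
  Diverge (a ∷ _) (b ∷ _) = ¬ a ≡ b

  diverge-[] : ∀ xs → Diverge xs []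
  diverge-[] [] = tt
  diverge-[] (_ ∷ _) = tt

  diverge-choice : ∀ γ α β → Diverge α β → Diverge γ α ⊎ Diverge γ β
  diverge-choice [] α β _ = inj₁ tt
  diverge-choice (g ∷ γ) [] β _ = inj₁ tt
  diverge-choice (g ∷ γ) (a ∷ α) [] _ = inj₂ tt
  diverge-choice (g ∷ γ) (a ∷ α) (b ∷ β) a≢b with g ≟ a
  ... | no g≢a = inj₁ g≢a
  ... | yes refl = inj₂ a≢b

  record Branching (x : V) (α β : List V) : Set where
    field
      hub : V
      stem left right : List V
      stem-chain : Chain x stem
      stem-end : end x stem ≡ hub
      left-chain : Chain hub left
      left-distinct : Distinct (hub ∷ left)
      left-end : end hub left ≡ end x α
      left-length : length α ≡ length stem + length left
      right-chain : Chain hub right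
      right-distinct : Distinct (hub ∷ right)
      right-end : end hub right ≡ end x β
      right-length : length β ≡ length stem + length right
      diverge : Diverge left right

  branch-at-root : ∀ {x α β} → Chain x α → Distinct (x ∷ α) → Chain x β → Distinct (x ∷ β) →
                   Diverge α β → Branching x α β
  branch-at-root {x} {α} {β} cα dα cβ dβ dv = record
    { hub = x ; stem = [] ; left = α ; right = β
    ; stem-chain = [] ; stem-end = refl
    ; left-chain = cα ; left-distinct = dα ; left-end = refl ; left-length = refl
    ; right-chain = cβ ; right-distinct = dβ ; right-end = refl ; right-length = refl
    ; diverge = dv }

  branching : ∀ x α β → Chain x α → Distinct (x ∷ α) → Chain x β → Distinct (x ∷ β) → Branching x α β
  branching x [] β cα dα cβ dβ = branch-at-root cα dα cβ dβ tt
  branching x (a ∷ α) [] cα dα cβ dβ = branch-at-root cα dα cβ dβ tt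
  branching x (a ∷ α) (b ∷ β) cα dα cβ dβ with a ≟ b
  ... | no a≢b = branch-at-root cα dα cβ dβ a≢b
  branching x (a ∷ α) (.a ∷ β) (xa ∷ cα) (_ ∷ dα) (_ ∷ cβ) (_ ∷ dβ) | yes refl =
    let open Branching (branching a α β cα dα cβ dβ) in record
      { hub = hub ; stem = a ∷ stem ; left = left ; right = right
      ; stem-chain = xa ∷ stem-chain ; stem-end = stem-end
      ; left-chain = left-chain ; left-distinct = left-distinct
      ; left-end = left-end ; left-length = cong suc left-length
      ; right-chain = right-chain ; right-distinct = right-distinct
      ; right-end = right-end ; right-length = cong suc right-length
      ; diverge = diverge }

module Acyclic {n : ℕ} (G : Graph n) (acyclic : ¬ Cycle G) where

  open Paths G
  open import Data.List.Membership.DecPropositional (_≟_ {n}) using (_∈?_)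

  -- s is not the first vertex of the list (the one after the start of a walk).
  NotSecond : V → List V → Set
  NotSecond s [] = ⊤
  NotSecond s (b ∷ _) = ¬ s ≡ b

  -- By
  -- induction along α: if s lies on c, β, the part of c, β up to s closes a
  -- cycle with the edge s — c; otherwise s is prepended to c, β and the next
  -- vertex of α takes its role.
  no-detour : ∀ c β s α → Chain c β → Distinct (c ∷ β) → Chain s α → Distinct (s ∷ α) →
              Adj G c s → c ∉ s ∷ α → NotSecond s β → end c β ≡ end s α → ⊥
  no-detour c β s α cβ dβ cα dα cs c∉ s≢b e with s ∈? (c ∷ β)
  no-detour c β s α cβ dβ cα dα cs c∉ s≢b e | yes (here refl) = c∉ (here refl)
  no-detour c (b ∷ β) s α cβ dβ cα dα cs c∉ s≢b e | yes (there s∈) with cut b β s∈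
  ... | [] , _ , b≡s = s≢b (≡-sym b≡s)
  ... | y ∷ ys , p , refl =
    acyclic (close-cycle (⊑-chain (refl ∷ p) cβ) (⊑-distinct (refl ∷ refl ∷ p) dβ) (sym G cs))
  no-detour c β s [] cβ dβ cα dα cs c∉ s≢b e | no s∉ = s∉ (subst (_∈ c ∷ β) e (end-∈ c β))
  no-detour c β s (t ∷ α) cβ dβ (st ∷ cα) (s∉α ∷ dα) cs c∉ s≢b e | no s∉ =
    no-detour s (c ∷ β) t α (sym G cs ∷ cβ) (s∉ ∷ dβ) cα dα st s∉α
      (λ t≡c → c∉ (there (here (≡-sym t≡c)))) e

  split-ends-differ : ∀ m a α b β → Chain m (a ∷ α) → Distinct (m ∷ a ∷ α) →
                      Chain m (b ∷ β) → Distinct (m ∷ b ∷ β) → ¬ a ≡ b → ¬ end a α ≡ end b β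
  split-ends-differ m a α b β (ma ∷ cα) (m∉ ∷ dα) cβ dβ a≢b e =
    no-detour m (b ∷ β) a α cβ dβ cα dα ma m∉ a≢b (≡-sym e)

  paths-same-length : ∀ a xs ys → Chain a xs → Distinct (a ∷ xs) → Chain a ys → Distinct (a ∷ ys) →
                      end a xs ≡ end a ys → length xs ≡ length ys
  paths-same-length a [] [] _ _ _ _ e = refl
  paths-same-length a [] (y ∷ ys) _ _ _ (a∉ ∷ _) e = ⊥-elim (a∉ (subst (_∈ y ∷ ys) (≡-sym e) (end-∈ y ys)))
  paths-same-length a (x ∷ xs) [] _ (a∉ ∷ _) _ _ e = ⊥-elim (a∉ (subst (_∈ x ∷ xs) e (end-∈ x xs)))
  paths-same-length a (x ∷ xs) (y ∷ ys) cx dx cy dy e with x ≟ y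
  ... | no x≢y = ⊥-elim (split-ends-differ a x xs y ys cx dx cy dy x≢y e)
  paths-same-length a (x ∷ xs) (.x ∷ ys) (_ ∷ cx) (_ ∷ dx) (_ ∷ cy) (_ ∷ dy) e | yes refl =
    cong suc (paths-same-length x xs ys cx dx cy dy e)

  diverging-disjoint : ∀ m α β → Chain m α → Distinct (m ∷ α) → Chain m β → Distinct (m ∷ β) →
                       Diverge α β → ∀ z → z ∈ α → z ∈ β → ⊥
  diverging-disjoint m (a ∷ α) (b ∷ β) cα dα cβ dβ a≢b z z∈α z∈β
    with cut a α z∈α | cut b β z∈β
  ... | ys , p , e | zs , q , e′ =
    split-ends-differ m a ys b zs (⊑-chain (refl ∷ p) cα) (⊑-distinct (refl ∷ refl ∷ p) dα)
      (⊑-chain (refl ∷ q) cβ) (⊑-distinct (refl ∷ refl ∷ q) dβ) a≢b (trans e (≡-sym e′))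

module TreeMetric {n : ℕ} (G : Graph n) (tree : IsTree G) where

  open Paths G public
  open Acyclic G (proj₂ (proj₂ tree))

  connect : ∀ a b → ∃[ k ] Walk G U a b k
  connect a b = proj₁ (proj₂ tree) a b tt tt

  route : ∀ a b → PathIn U a b (proj₁ (connect a b))
  route a b = proj₂ (walk⇒path (proj₂ (connect a b)))

  δ : V → V → ℕ
  δ a b = length (verts (route a b))

  path-length : ∀ {a b} xs → Chain a xs → Distinct (a ∷ xs) → end a xs ≡ b → length xs ≡ δ a b
  path-length {a} {b} xs c d e =
    paths-same-length a xs (verts r) c d (chain r) (distinct r) (trans e (≡-sym (ends r)))
    where
      r : PathIn U a b (proj₁ (connect a b))
      r = route a b

  pathIn-length : ∀ {P a b k} (p : PathIn P a b k) → length (verts p) ≡ δ a b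
  pathIn-length p = path-length (verts p) (chain p) (distinct p) (ends p)

  chain-length-≥ : ∀ {a} xs → Chain a xs → δ a (end a xs) ≤ length xs
  chain-length-≥ {a} xs c = subst (_≤ length xs) (pathIn-length p) (short p)
    where
      p : PathIn U a (end a xs) (length xs)
      p = erase xs c (universal-U xs)

  dist≡δ : ∀ {S a b k} → Dist G S a b k → k ≡ δ a b
  dist≡δ (w , minimal) with walk⇒path w
  ... | sa , p = ≤-antisym (subst (_ ≤_) (pathIn-length p) (minimal _ (path⇒walk sa p)))
                           (subst (_≤ _) (pathIn-length p) (short p))

  δ-is-dist : ∀ {S a b k} → Walk G S a b k → Dist G S a b (δ a b)
  δ-is-dist w with walk⇒path w
  ... | sa , p = subst (Walk G _ _ _) (pathIn-length p) (path⇒walk sa p) , shortest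
    where
      shortest : ∀ k′ → Walk G _ _ _ k′ → δ _ _ ≤ k′
      shortest k′ w′ with walk⇒path w′
      ... | _ , p′ = subst (_≤ k′) (pathIn-length p′) (short p′)

  glue : ∀ m α β → Chain m α → Distinct (m ∷ α) → Chain m β → Distinct (m ∷ β) → Diverge α β →
         δ (end m α) (end m β) ≡ length α + length β
  glue m α β cα dα cβ dβ dv =
    trans (≡-sym (path-length (revGlue m α β) (revGlue-chain m α β cα cβ)
                   (revGlue-distinct m α β dα dβ (diverging-disjoint m α β cα dα cβ dβ dv))
                   (revGlue-end m α β)))
          (revGlue-length m α β)

  δ-sym : ∀ a b → δ a b ≡ δ b a
  δ-sym a b = begin
    δ a b                          ≡⟨ ≡-sym (+-identityʳ _) ⟩
    δ a b + 0                      ≡⟨ ≡-sym (glue a (verts r) [] (chain r) (distinct r) [] ((λ ()) ∷ []) (diverge-[] _)) ⟩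
    δ (end a (verts r)) a          ≡⟨ cong (λ z → δ z a) (ends r) ⟩
    δ b a                          ∎
    where
      open ≡-Reasoning
      r : PathIn U a b (proj₁ (connect a b))
      r = route a b

  δ-triangle : ∀ a b c → δ a c ≤ δ a b + δ b c
  δ-triangle a b c = subst₂ _≤_ (cong (δ a) end-pq) (length-++ (verts p))
    (chain-length-≥ (verts p ++ verts q) (chain-++ (verts p) (verts q) (chain p) q-chain))
    where
      p : PathIn U a b (proj₁ (connect a b))
      p = route a b
      q : PathIn U b c (proj₁ (connect b c))
      q = route b c
      q-chain : Chain (end a (verts p)) (verts q)
      q-chain = subst (λ z → Chain z (verts q)) (≡-sym (ends p)) (chain q)
      end-pq : end a (verts p ++ verts q) ≡ c
      end-pq = trans (end-++ a (verts p) (verts q)) (subst (λ z → end z (verts q) ≡ c) (≡-sym (ends p)) (ends q))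

  -- The path from m to y leaves m away from one of two diverging paths α, β,
  -- so that branch end is as far from y as m is, plus the branch length.
  leaves-one-branch : ∀ m α β y → Chain m α → Distinct (m ∷ α) → Chain m β → Distinct (m ∷ β) →
                      Diverge α β → δ y (end m α) ≡ δ m y + length α ⊎ δ y (end m β) ≡ δ m y + length β
  leaves-one-branch m α β y cα dα cβ dβ dv = choose (diverge-choice (verts r) α β dv)
    where
      r : PathIn U m y (proj₁ (connect m y))
      r = route m y
      from-y : ∀ γ → Chain m γ → Distinct (m ∷ γ) → Diverge (verts r) γ →
               δ y (end m γ) ≡ δ m y + length γ
      from-y γ cγ dγ dv′ = subst (λ z → δ z (end m γ) ≡ δ m y + length γ) (ends r)
                             (glue m (verts r) γ (chain r) (distinct r) cγ dγ dv′)
      choose : Diverge (verts r) α ⊎ Diverge (verts r) β →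
               δ y (end m α) ≡ δ m y + length α ⊎ δ y (end m β) ≡ δ m y + length β
      choose (inj₁ dvα) = inj₁ (from-y α cα dα dvα)
      choose (inj₂ dvβ) = inj₂ (from-y β cβ dβ dvβ)

  -- The key metric property: a vertex within δ u v of both u and v is, from
  -- any y, no farther than u or than v is.  The comparison happens at the
  -- branch point of the paths x → u and x → v.
  far-from-both : ∀ x y u v → δ x u ≤ δ u v → δ x v ≤ δ u v → δ x y ≤ δ y u ⊎ δ x y ≤ δ y v
  far-from-both x y u v xu≤uv xv≤uv =
    at (branching x (verts p) (verts q) (chain p) (distinct p) (chain q) (distinct q))
    where
      p : PathIn U x u (proj₁ (connect x u))
      p = route x u
      q : PathIn U x v (proj₁ (connect x v))
      q = route x v
      at : Branching x (verts p) (verts q) → δ x y ≤ δ y u ⊎ δ x y ≤ δ y v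
      at br = conclude (leaves-one-branch hub left right y left-chain left-distinct right-chain right-distinct diverge)
        where
          open Branching br
          open ≤-Reasoning
          hub-u : end hub left ≡ u
          hub-u = trans left-end (ends p)
          hub-v : end hub right ≡ v
          hub-v = trans right-end (ends q)
          uv : δ u v ≡ length left + length right
          uv = subst₂ (λ s t → δ s t ≡ length left + length right) hub-u hub-v
                 (glue hub left right left-chain left-distinct right-chain right-distinct diverge)
          -- x is no farther from the hub than u and v are.
          stem≤right : length stem ≤ length right
          stem≤right = +-cancelʳ-≤ (length left) (length stem) (length right)
                         (subst₂ _≤_ left-length (trans uv (+-comm (length left) (length right))) xu≤uv)
          stem≤left : length stem ≤ length left
          stem≤left = +-cancelʳ-≤ (length right) (length stem) (length left)
                        (subst₂ _≤_ right-length uv xv≤uv)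
          via-hub : ∀ t → length stem ≤ t → δ x y ≤ δ hub y + t
          via-hub t stem≤t = begin
            δ x y             ≤⟨ δ-triangle x hub y ⟩
            δ x hub + δ hub y ≤⟨ +-monoˡ-≤ (δ hub y) (≤-trans x-hub stem≤t) ⟩
            t + δ hub y       ≡⟨ +-comm t (δ hub y) ⟩
            δ hub y + t       ∎
            where
              x-hub : δ x hub ≤ length stem
              x-hub = subst (λ z → δ x z ≤ length stem) stem-end (chain-length-≥ stem stem-chain)
          conclude : δ y (end hub left) ≡ δ hub y + length left ⊎ δ y (end hub right) ≡ δ hub y + length right →
                     δ x y ≤ δ y u ⊎ δ x y ≤ δ y v
          conclude (inj₁ e) = inj₁ (subst (δ x y ≤_) (trans (≡-sym e) (cong (δ y) hub-u)) (via-hub _ stem≤left))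
          conclude (inj₂ e) = inj₂ (subst (δ x y ≤_) (trans (≡-sym e) (cong (δ y) hub-v)) (via-hub _ stem≤right))

  diam-attained : ∀ {S d} → IsDiam G S d → ∃[ a ] ∃[ b ] S a × S b × δ a b ≡ d
  diam-attained ((a , b , sa , sb , dist) , _) = a , b , sa , sb , ≡-sym (dist≡δ dist)

  diam-bound : ∀ {S d a b} → Connected G S → IsDiam G S d → S a → S b → δ a b ≤ d
  diam-bound conn (_ , maximal) sa sb = maximal _ _ _ sa sb (δ-is-dist (proj₂ (conn _ _ sa sb)))

  diam-≤ : ∀ {S d D} → IsDiam G S d → (∀ {a b} → S a → S b → δ a b ≤ D) → d ≤ D
  diam-≤ diam bounded with diam-attained diam
  ... | a , b , sa , sb , refl = bounded sa sb

  diam-mono : ∀ {S S′ d d′} → (∀ {z} → S z → S′ z) → IsDiam G S d → IsDiam G S′ d′ → d ≤ d′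
  diam-mono S⊆S′ ((a , b , sa , sb , dist) , _) (_ , maximal′) =
    subst (_≤ _) (≡-sym (dist≡δ dist))
      (maximal′ a b _ (S⊆S′ sa) (S⊆S′ sb) (δ-is-dist (lift-walk S⊆S′ (proj₁ dist))))

  union-bound : ∀ {S₁ S₂ u v d} → Connected G S₂ → IsDiam G S₂ d →
                S₁ u → S₁ v → S₂ u → S₂ v → (∀ {x y} → S₁ x → S₁ y → δ x y ≤ δ u v) →
                ∀ {x y} → (S₁ ∪ S₂) x → (S₁ ∪ S₂) y → δ x y ≤ d
  union-bound {S₁} {S₂} {u} {v} {d} conn₂ diam₂ u₁ v₁ u₂ v₂ S₁-within = bound
    where
      cross : ∀ {x y} → S₁ x → S₂ y → δ x y ≤ d
      cross {x} {y} x₁ y₂ with far-from-both x y u v (S₁-within x₁ u₁) (S₁-within x₁ v₁)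
      ... | inj₁ xy≤yu = ≤-trans xy≤yu (diam-bound conn₂ diam₂ y₂ u₂)
      ... | inj₂ xy≤yv = ≤-trans xy≤yv (diam-bound conn₂ diam₂ y₂ v₂)
      bound : ∀ {x y} → (S₁ ∪ S₂) x → (S₁ ∪ S₂) y → δ x y ≤ d
      bound (inj₁ x₁) (inj₁ y₁) = ≤-trans (S₁-within x₁ y₁) (diam-bound conn₂ diam₂ u₂ v₂)
      bound (inj₁ x₁) (inj₂ y₂) = cross x₁ y₂
      bound (inj₂ x₂) (inj₁ y₁) = subst (_≤ d) (δ-sym _ _) (cross y₁ x₂)
      bound (inj₂ x₂) (inj₂ y₂) = diam-bound conn₂ diam₂ x₂ y₂

-- Choose u, v ∈ T₁ ∩ T₂ realising diam(T₁ ∩ T₂) = diam(T₁); then T₁ stays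
-- within δ u v, 'union-bound' gives diam(T₁ ∪ T₂) ≤ diam(T₂), and
-- T₂ ⊆ T₁ ∪ T₂ gives the reverse inequality.  (Nonemptiness of T₁ ∩ T₂ is
-- already implied by its diameter being attained.)
lemma3p2 : ∀ {n} (T : Graph n) (T₁ T₂ : VSet n) →
    IsTree T → IsSubtree T T₁ → IsSubtree T T₂ →
    Nonempty (T₁ ∩ T₂) →
    ∀ (d₁ d₂ d₁₂ d∪ : ℕ) →
    IsDiam T T₁ d₁ → IsDiam T T₂ d₂ →
    IsDiam T (T₁ ∩ T₂) d₁₂ → IsDiam T (T₁ ∪ T₂) d∪ →
    d₁₂ ≡ d₁ → d∪ ≡ d₂
lemma3p2 T T₁ T₂ tree conn₁ conn₂ _ d₁ d₂ d₁₂ d∪ diam₁ diam₂ diam₁₂ diam∪ refl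
  with TreeMetric.diam-attained T tree diam₁₂
... | u , v , (u₁ , u₂) , (v₁ , v₂) , δuv≡d₁ =
  ≤-antisym (diam-≤ diam∪ (union-bound conn₂ diam₂ u₁ v₁ u₂ v₂ T₁-within))
            (diam-mono inj₂ diam₂ diam∪)
  where
    open TreeMetric T tree
    T₁-within : ∀ {x y} → T₁ x → T₁ y → δ x y ≤ δ u v
    T₁-within x₁ y₁ = subst (_ ≤_) (≡-sym δuv≡d₁) (diam-bound conn₁ diam₁ x₁ y₁)
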